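{- If $T$ is a finite tree and $(S,T',v_s,v_t)$ is a starlike splitting of $T$, then $\nu_2(T)=\nu_2(S)+\nu_2(T')$.
   Context: A $2$-matching of a graph $G$ is a subset of $E(G)$ such that every vertex is incident to at most $2$ edges of the subset; the $2$-matching number $\nu_2(G)$ is the maximum cardinality of a $2$-matching of $G$. A starlike tree is a tree with exactly one vertex of degree at least $3$ (its central vertex). If a tree $T$ has at least two vertices of degree at least $3$, a starlike splitting of $T$ is a $4$-tuple $(S,T',v_s,v_t)$ where $S$ is a starlike tree, $T'$ is a tree, $v_s$ is a leaf of $S$ adjacent to the central vertex of $S$, $v_t\in V(T')$, and $T$ is obtained from $S$ and $T'$ by identifying $v_s$ with $v_t$. -}

module Defs where

open import Data.Bool using (Bool; true; false; if_then_else_; _∧_)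
open import Data.Nat using (ℕ; zero; suc; _+_; _≤_; _<ᵇ_)
open import Data.Fin using (Fin; toℕ)
import Data.Fin as F
open import Data.List using (List; []; _∷_; length; _∷ʳ_)
open import Data.List.Relation.Unary.Linked using (Linked)
open import Data.List.Relation.Unary.Unique.Propositional using (Unique)
open import Data.Product using (Σ; ∃; ∃-syntax; _×_; _,_)
open import Data.Sum using (_⊎_)
open import Relation.Nullary using (¬_)
open import Relation.Binary.PropositionalEquality using (_≡_)
open import Relation.Binary.Construct.Closure.ReflexiveTransitive using (Star)

record Graph (n : ℕ) : Set where
  field
    adj    : Fin n → Fin n → Bool
    sym    : ∀ i j → adj i j ≡ adj j i
    irrefl : ∀ i → adj i i ≡ false
open Graph public

Adj : ∀ {n} → Graph n → Fin n → Fin n → Set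
Adj G i j = adj G i j ≡ true

sumFin : ∀ {n} → (Fin n → ℕ) → ℕ
sumFin {zero}  f = 0
sumFin {suc n} f = f F.zero + sumFin (λ i → f (F.suc i))

degB : ∀ {n} → (Fin n → Fin n → Bool) → Fin n → ℕ
degB R i = sumFin (λ j → if R i j then 1 else 0)

deg : ∀ {n} → Graph n → Fin n → ℕ
deg G = degB (adj G)

-- Number of unordered pairs {i,j} (counted once, via toℕ i < toℕ j) with R i j = true.
-- For a symmetric R this is the number of edges of R.
edgeCount : ∀ {n} → (Fin n → Fin n → Bool) → ℕ
edgeCount R = sumFin (λ i → sumFin (λ j → if (toℕ i <ᵇ toℕ j) ∧ R i j then 1 else 0))

Connected : ∀ {n} → Graph n → Set
Connected G = ∀ i j → Star (Adj G) i j

HasCycle : ∀ {n} → Graph n → Set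
HasCycle {n} G = Σ (Fin n) λ v → Σ (List (Fin n)) λ ys →
  (2 ≤ length ys) × Unique (v ∷ ys) × Linked (Adj G) (v ∷ ys ∷ʳ v)

Acyclic : ∀ {n} → Graph n → Set
Acyclic G = ¬ HasCycle G

IsTree : ∀ {n} → Graph n → Set
IsTree {n} G = (1 ≤ n) × Connected G × Acyclic G

IsTwoMatching : ∀ {n} → Graph n → (Fin n → Fin n → Bool) → Set
IsTwoMatching {n} G M =
  (∀ i j → M i j ≡ M j i) ×
  (∀ i j → M i j ≡ true → Adj G i j) ×
  (∀ i → degB M i ≤ 2)

TwoMatchingNumber : ∀ {n} → Graph n → ℕ → Set
TwoMatchingNumber {n} G k =
  (∃[ M ] (IsTwoMatching G M × edgeCount M ≡ k)) ×
  (∀ M → IsTwoMatching G M → edgeCount M ≤ k)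

IsStarlikeWithCentre : ∀ {n} → Graph n → Fin n → Set
IsStarlikeWithCentre {n} G c = IsTree G × 3 ≤ deg G c × (∀ v → 3 ≤ deg G v → v ≡ c)

TwoBranchVertices : ∀ {n} → Graph n → Set
TwoBranchVertices {n} G = Σ (Fin n) λ u → Σ (Fin n) λ w → ¬ (u ≡ w) × 3 ≤ deg G u × 3 ≤ deg G w

-- T is obtained from S and T' by identifying vs ∈ V(S) with vt ∈ V(T'):
-- f, g embed S and T' into T, their images cover V(T) and meet only in f vs = g vt,
-- both embeddings preserve and reflect adjacency, and every edge of T comes from S or T'.
IsGluing : ∀ {n p q} → Graph n → Graph p → Graph q → Fin p → Fin q → Set
IsGluing {n} {p} {q} T S T' vs vt = Σ (Fin p → Fin n) λ f → Σ (Fin q → Fin n) λ g →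
  (∀ a b → f a ≡ f b → a ≡ b) ×
  (∀ a b → g a ≡ g b → a ≡ b) ×
  (f vs ≡ g vt) ×
  (∀ a b → f a ≡ g b → (a ≡ vs × b ≡ vt)) ×
  (∀ i → (∃[ a ] f a ≡ i) ⊎ (∃[ b ] g b ≡ i)) ×
  (∀ a b → adj T (f a) (f b) ≡ adj S a b) ×
  (∀ a b → adj T (g a) (g b) ≡ adj T' a b) ×
  (∀ i j → Adj T i j →
     (∃[ a ] ∃[ b ] (f a ≡ i × f b ≡ j)) ⊎ (∃[ a ] ∃[ b ] (g a ≡ i × g b ≡ j)))

IsStarlikeSplitting : ∀ {n p q} → Graph n → Graph p → Graph q → Fin p → Fin q → Set
IsStarlikeSplitting {n} {p} {q} T S T' vs vt =
  TwoBranchVertices T ×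
  (Σ (Fin p) λ c → IsStarlikeWithCentre S c × deg S vs ≡ 1 × Adj S vs c) ×
  IsTree T' ×
  IsGluing T S T' vs vt

module Submission where

-- Counting a 2-matching M by its degree sum Σᵢ deg M i = 2|M| turns both inequalities into
-- reindexings of finite sums along the embeddings of S and T′ into T.
--
-- ν₂(T) ≤ ν₂(S) + ν₂(T′): a 2-matching of T restricts to 2-matchings of S and T′, and every edge
-- of T lies in one of the two copies.
--
-- ν₂(T) ≥ ν₂(S) + ν₂(T′): some maximum 2-matching of S avoids the leaf vs. If one uses the edge
-- vs c, the centre c, of degree ≥ 3 but matching degree ≤ 2, has a neighbour u with cu
-- unmatched; u is not a branch vertex, so it has degree ≤ 2 and matching degree ≤ 1, and
-- exchanging vs c for c u yields a maximum 2-matching avoiding vs. Its union with a maximum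
-- 2-matching of T′ is a 2-matching of T, since the two copies share only the vertex vs = vt.

open import Defs hiding (sym)
open import Data.Bool using (Bool; true; false; if_then_else_; _∧_; _∨_; not)
open import Data.Bool.Properties using (∧-zeroʳ; ∧-comm; ∨-comm; ∨-identityʳ; ∨-zeroʳ)
open import Data.Empty using (⊥-elim)
import Data.Fin as F
open import Data.Fin using (Fin; toℕ)
open import Data.Fin.Properties using (_≟_; any?; toℕ-injective)
open import Data.Nat using (ℕ; zero; suc; _+_; _*_; _≤_; _<_; _<ᵇ_; z≤n; s≤s)
open import Data.Nat.Properties hiding (_≟_)
open import Algebra.Properties.CommutativeSemigroup +-commutativeSemigroup using (interchange)
open import Data.Product using (∃; ∃-syntax; _×_; _,_; proj₁; proj₂)
open import Data.Sum using (_⊎_; inj₁; inj₂)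
open import Function using (_∘_)
open import Function.Definitions using (Injective)
open import Relation.Nullary using (¬_; yes; no; does; Dec)
open import Relation.Nullary.Decidable using (dec-true; dec-false; _×-dec_; _⊎-dec_)
open import Relation.Binary using (tri<; tri≈; tri>)
open import Relation.Binary.PropositionalEquality

-- Finite sums and indicators

sum-cong : ∀ {n} {f g : Fin n → ℕ} → (∀ i → f i ≡ g i) → sumFin f ≡ sumFin g
sum-cong {zero}  f≗g = refl
sum-cong {suc n} f≗g = cong₂ _+_ (f≗g F.zero) (sum-cong (f≗g ∘ F.suc))

sum-zero : ∀ {n} {f : Fin n → ℕ} → (∀ i → f i ≡ 0) → sumFin f ≡ 0
sum-zero {zero}  f≗0 = refl
sum-zero {suc n} f≗0 = cong₂ _+_ (f≗0 F.zero) (sum-zero (f≗0 ∘ F.suc))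

sum-mono : ∀ {n} {f g : Fin n → ℕ} → (∀ i → f i ≤ g i) → sumFin f ≤ sumFin g
sum-mono {zero}  f≤g = z≤n
sum-mono {suc n} f≤g = +-mono-≤ (f≤g F.zero) (sum-mono (f≤g ∘ F.suc))

sum-+ : ∀ {n} (f g : Fin n → ℕ) → sumFin (λ i → f i + g i) ≡ sumFin f + sumFin g
sum-+ {zero}  f g = refl
sum-+ {suc n} f g =
  trans (cong (f F.zero + g F.zero +_) (sum-+ (f ∘ F.suc) (g ∘ F.suc)))
        (interchange (f F.zero) (g F.zero) _ _)

sum-comm : ∀ {m n} (h : Fin m → Fin n → ℕ) →
           sumFin (λ i → sumFin (h i)) ≡ sumFin (λ j → sumFin (λ i → h i j))
sum-comm {zero} {n} h = sym (sum-zero {n} (λ _ → refl))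
sum-comm {suc m} h =
  trans (cong (sumFin (h F.zero) +_) (sum-comm (h ∘ F.suc))) (sym (sum-+ (h F.zero) _))

sum-<-mono : ∀ {n} {f g : Fin n → ℕ} x → (∀ i → f i ≤ g i) → f x < g x → sumFin f < sumFin g
sum-<-mono F.zero    f≤g fx<gx = +-mono-<-≤ fx<gx (sum-mono (f≤g ∘ F.suc))
sum-<-mono (F.suc x) f≤g fx<gx = +-mono-≤-< (f≤g F.zero) (sum-<-mono x (f≤g ∘ F.suc) fx<gx)

sum-<-witness : ∀ {n} (f g : Fin n → ℕ) → sumFin f < sumFin g → ∃[ i ] f i < g i
sum-<-witness {suc n} f g Σf<Σg with f F.zero <? g F.zero
... | yes f₀<g₀ = F.zero , f₀<g₀
... | no  f₀≮g₀ =
  let i , fi<gi = sum-<-witness (f ∘ F.suc) (g ∘ F.suc) (≰⇒> λ Σg≤Σf →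
                    <⇒≱ Σf<Σg (+-mono-≤ (≮⇒≥ f₀≮g₀) Σg≤Σf))
  in F.suc i , fi<gi

χ : Bool → ℕ
χ b = if b then 1 else 0

χ-mono : ∀ {b b′} → (b ≡ true → b′ ≡ true) → χ b ≤ χ b′
χ-mono {false} b⇒b′ = z≤n
χ-mono {true}  b⇒b′ rewrite b⇒b′ refl = ≤-refl

χ-∨ : ∀ b b′ → χ (b ∨ b′) ≤ χ b + χ b′
χ-∨ false b′ = ≤-refl
χ-∨ true  b′ = s≤s z≤n

χ-∨-disjoint : ∀ {b b′} → (b ≡ true → b′ ≡ false) → χ (b ∨ b′) ≡ χ b + χ b′
χ-∨-disjoint {false} b⇒¬b′ = refl
χ-∨-disjoint {true}  b⇒¬b′ rewrite b⇒¬b′ refl = refl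

χ-< : ∀ {b b′} → χ b < χ b′ → b ≡ false × b′ ≡ true
χ-< {false} {true}  _ = refl , refl
χ-< {true}  {true}  (s≤s ())

δ : ∀ {n} → Fin n → Fin n → ℕ
δ x y = χ (does (x ≟ y))

δ-refl : ∀ {n} (x : Fin n) → δ x x ≡ 1
δ-refl x = cong χ (dec-true (x ≟ x) refl)

δ-≢ : ∀ {n} {x y : Fin n} → x ≢ y → δ x y ≡ 0
δ-≢ {x = x} {y} x≢y = cong χ (dec-false (x ≟ y) x≢y)

sum-δ : ∀ {n} (x : Fin n) (h : Fin n → ℕ) → sumFin (λ i → δ x i * h i) ≡ h x
sum-δ {suc n} F.zero h =
  trans (cong₂ _+_ (+-identityʳ (h F.zero)) (sum-zero {n} (λ i → refl))) (+-identityʳ (h F.zero))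
sum-δ (F.suc x)      h = sum-δ x (h ∘ F.suc)

sum-δ-one : ∀ {n} (x : Fin n) → sumFin (δ x) ≡ 1
sum-δ-one x = trans (sum-cong (λ i → sym (*-identityʳ (δ x i)))) (sum-δ x (λ _ → 1))

Image : ∀ {p n} → (Fin p → Fin n) → Fin n → Set
Image f i = ∃[ a ] f a ≡ i

image? : ∀ {p n} (f : Fin p → Fin n) i → Dec (Image f i)
image? f i = any? (λ a → f a ≟ i)

module _ {p n} {f : Fin p → Fin n} (f-inj : Injective _≡_ _≡_ f) where

  δ-injective : ∀ a b → δ (f a) (f b) ≡ δ b a
  δ-injective a b with b ≟ a
  ... | yes refl = δ-refl (f a)
  ... | no  b≢a  = δ-≢ (b≢a ∘ sym ∘ f-inj)

  sum-image : (h : Fin n → ℕ) → (∀ i → ¬ Image f i → h i ≡ 0) → sumFin h ≡ sumFin (h ∘ f)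
  sum-image h h-off = begin
    sumFin h                                       ≡⟨ sum-cong weighted ⟩
    sumFin (λ i → sumFin (λ a → δ (f a) i * h i))  ≡⟨ sum-comm (λ i a → δ (f a) i * h i) ⟩
    sumFin (λ a → sumFin (λ i → δ (f a) i * h i))  ≡⟨ sum-cong (λ a → sum-δ (f a) h) ⟩
    sumFin (h ∘ f)                                 ∎
    where
    open ≡-Reasoning
    -- every i in the image of f has exactly one preimage
    weighted : ∀ i → h i ≡ sumFin (λ a → δ (f a) i * h i)
    weighted i with image? f i
    ... | yes (a₀ , refl) = sym (trans (sum-cong (λ a → cong (_* h (f a₀)) (δ-injective a a₀)))
                                       (sum-δ a₀ (λ _ → h (f a₀))))
    ... | no  i∉f = trans (h-off i i∉f) (sym (sum-zero λ a →
                      trans (cong (δ (f a) i *_) (h-off i i∉f)) (*-zeroʳ (δ (f a) i))))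

-- Boolean relations

BRel : ℕ → Set
BRel n = Fin n → Fin n → Bool

_⊆_ : ∀ {n} → BRel n → BRel n → Set
R ⊆ R′ = ∀ i j → R i j ≡ true → R′ i j ≡ true

Disjoint : ∀ {n} → BRel n → BRel n → Set
Disjoint R R′ = ∀ i j → R i j ≡ true → R′ i j ≡ false

_∪_ : ∀ {n} → BRel n → BRel n → BRel n
(R ∪ R′) i j = R i j ∨ R′ i j

_∖_ : ∀ {n} → BRel n → BRel n → BRel n
(R ∖ R′) i j = R i j ∧ not (R′ i j)

degreeSum : ∀ {n} → BRel n → ℕ
degreeSum R = sumFin (degB R)

module _ {n} {R R′ : BRel n} where

  degB-mono : R ⊆ R′ → ∀ i → degB R i ≤ degB R′ i
  degB-mono R⊆R′ i = sum-mono (λ j → χ-mono (R⊆R′ i j))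

  degB-< : R ⊆ R′ → ∀ {i j} → R i j ≡ false → R′ i j ≡ true → degB R i < degB R′ i
  degB-< R⊆R′ {i} {j} ¬Rij R′ij =
    sum-<-mono j (λ k → χ-mono (R⊆R′ i k))
               (subst₂ (λ b b′ → χ b < χ b′) (sym ¬Rij) (sym R′ij) ≤-refl)

  degB-∪ : ∀ i → degB (R ∪ R′) i ≤ degB R i + degB R′ i
  degB-∪ i =
    ≤-trans (sum-mono (λ j → χ-∨ (R i j) (R′ i j))) (≤-reflexive (sum-+ (χ ∘ R i) (χ ∘ R′ i)))

  degreeSum-mono : R ⊆ R′ → degreeSum R ≤ degreeSum R′
  degreeSum-mono R⊆R′ = sum-mono (degB-mono R⊆R′)

  degreeSum-∪ : degreeSum (R ∪ R′) ≤ degreeSum R + degreeSum R′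
  degreeSum-∪ = ≤-trans (sum-mono degB-∪) (≤-reflexive (sum-+ (degB R) (degB R′)))

  degreeSum-∪-disjoint : Disjoint R R′ → degreeSum (R ∪ R′) ≡ degreeSum R + degreeSum R′
  degreeSum-∪-disjoint R∩R′≡∅ =
    trans (sum-cong λ i → trans (sum-cong (λ j → χ-∨-disjoint (R∩R′≡∅ i j)))
                               (sum-+ (χ ∘ R i) (χ ∘ R′ i)))
          (sum-+ (degB R) (degB R′))

<ᵇ-true : ∀ {m n} → m < n → (m <ᵇ n) ≡ true
<ᵇ-true = dec-true (_ <? _)

<ᵇ-false : ∀ {m n} → ¬ m < n → (m <ᵇ n) ≡ false
<ᵇ-false = dec-false (_ <? _)

handshake : ∀ {n} (R : BRel n) → (∀ i j → R i j ≡ R j i) → (∀ i → R i i ≡ false) →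
            degreeSum R ≡ 2 * edgeCount R
handshake R R-sym R-irr = begin
  degreeSum R                                         ≡⟨ sum-cong (λ i → sum-cong (halves i)) ⟩
  sumFin (λ i → sumFin (λ j → A i j + A j i))         ≡⟨ sum-cong (λ i → sum-+ (A i) (λ j → A j i)) ⟩
  sumFin (λ i → sumFin (A i) + sumFin (λ j → A j i))  ≡⟨ sum-+ (λ i → sumFin (A i)) _ ⟩
  edgeCount R + sumFin (λ i → sumFin (λ j → A j i))   ≡⟨ cong (edgeCount R +_) (sum-comm (λ i j → A j i)) ⟩
  edgeCount R + edgeCount R                           ≡⟨ cong (edgeCount R +_) (+-identityʳ _) ⟨
  2 * edgeCount R                                     ∎
  where
  open ≡-Reasoning
  A : Fin _ → Fin _ → ℕ
  A i j = χ ((toℕ i <ᵇ toℕ j) ∧ R i j)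
  halves : ∀ i j → χ (R i j) ≡ A i j + A j i
  halves i j with <-cmp (toℕ i) (toℕ j)
  ... | tri< i<j _ j≮i rewrite <ᵇ-true i<j | <ᵇ-false j≮i = sym (+-identityʳ _)
  ... | tri> i≮j _ j<i rewrite <ᵇ-true j<i | <ᵇ-false i≮j = cong χ (R-sym i j)
  ... | tri≈ _ i≡j _ rewrite toℕ-injective i≡j | R-irr j | ∧-zeroʳ (toℕ j <ᵇ toℕ j) = refl

restrict : ∀ {p n} → (Fin p → Fin n) → BRel n → BRel p
restrict f R a b = R (f a) (f b)

extend : ∀ {p n} → (Fin p → Fin n) → BRel p → BRel n
extend f R i j with image? f i | image? f j
... | yes (a , _) | yes (b , _) = R a b
... | _           | _           = false

module _ {p n} {f : Fin p → Fin n} {R : BRel p} where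

  extend-true : ∀ {i j} → extend f R i j ≡ true → ∃[ a ] ∃[ b ] (f a ≡ i × f b ≡ j × R a b ≡ true)
  extend-true {i} {j} e with image? f i | image? f j
  extend-true e  | yes (a , fa≡i) | yes (b , fb≡j) = a , b , fa≡i , fb≡j , e
  extend-true () | yes _          | no _
  extend-true () | no _           | _

  extend-outsideˡ : ∀ {i} j → ¬ Image f i → extend f R i j ≡ false
  extend-outsideˡ {i} j i∉f with image? f i
  ... | yes i∈f = ⊥-elim (i∉f i∈f)
  ... | no  _   = refl

  extend-outsideʳ : ∀ i {j} → ¬ Image f j → extend f R i j ≡ false
  extend-outsideʳ i {j} j∉f with image? f i | image? f j
  ... | _     | yes j∈f = ⊥-elim (j∉f j∈f)
  ... | yes _ | no  _   = refl
  ... | no  _ | no  _   = refl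

  degB-extend-outside : ∀ {i} → ¬ Image f i → degB (extend f R) i ≡ 0
  degB-extend-outside i∉f = sum-zero (λ j → cong χ (extend-outsideˡ j i∉f))

module _ {p n} {f : Fin p → Fin n} (f-inj : Injective _≡_ _≡_ f) {R : BRel p} where

  extend-image : ∀ a b → extend f R (f a) (f b) ≡ R a b
  extend-image a b with image? f (f a) | image? f (f b)
  ... | yes (a′ , fa′≡fa) | yes (b′ , fb′≡fb) = cong₂ R (f-inj fa′≡fa) (f-inj fb′≡fb)
  ... | no  fa∉f          | _                 = ⊥-elim (fa∉f (a , refl))
  ... | yes _             | no  fb∉f          = ⊥-elim (fb∉f (b , refl))

  extend-sym : (∀ a b → R a b ≡ R b a) → ∀ i j → extend f R i j ≡ extend f R j i
  extend-sym R-sym i j = by-cases (image? f i) (image? f j)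
    where
    by-cases : Dec (Image f i) → Dec (Image f j) → extend f R i j ≡ extend f R j i
    by-cases (yes (a , refl)) (yes (b , refl)) =
      trans (extend-image a b) (trans (R-sym a b) (sym (extend-image b a)))
    by-cases (no i∉f) _ = trans (extend-outsideˡ j i∉f) (sym (extend-outsideʳ j i∉f))
    by-cases (yes _) (no j∉f) = trans (extend-outsideʳ i j∉f) (sym (extend-outsideˡ i j∉f))

  degB-extend-image : ∀ a → degB (extend f R) (f a) ≡ degB R a
  degB-extend-image a =
    trans (sum-image f-inj (χ ∘ extend f R (f a)) (λ j j∉f → cong χ (extend-outsideʳ (f a) j∉f)))
          (sum-cong (λ b → cong χ (extend-image a b)))

  degreeSum-extend : degreeSum (extend f R) ≡ degreeSum R
  degreeSum-extend =
    trans (sum-image f-inj (degB (extend f R)) (λ i → degB-extend-outside))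
          (sum-cong degB-extend-image)

module _ {n p} {T : Graph n} {S : Graph p} {f : Fin p → Fin n}
         (f-adj : ∀ a b → adj T (f a) (f b) ≡ adj S a b) where

  extend-⊆ : ∀ {R} → R ⊆ adj S → extend f R ⊆ adj T
  extend-⊆ {R} R⊆S i j e with extend-true {f = f} {R} e
  ... | a , b , refl , refl , Rab = trans (f-adj a b) (R⊆S a b Rab)

  restrict-twoMatching : Injective _≡_ _≡_ f →
                         ∀ {M} → IsTwoMatching T M → IsTwoMatching S (restrict f M)
  restrict-twoMatching f-inj {M} (M-sym , M⊆T , M-deg) =
    (λ a b → M-sym (f a) (f b)) ,
    (λ a b Mab → trans (sym (f-adj a b)) (M⊆T (f a) (f b) Mab)) ,
    λ a → begin
      degB (restrict f M) a                   ≡⟨ degB-extend-image f-inj a ⟨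
      degB (extend f (restrict f M)) (f a)    ≤⟨ degB-mono extend-restrict-⊆ (f a) ⟩
      degB M (f a)                            ≤⟨ M-deg (f a) ⟩
      2                                       ∎
    where
    open ≤-Reasoning
    extend-restrict-⊆ : extend f (restrict f M) ⊆ M
    extend-restrict-⊆ i j e with extend-true {f = f} {restrict f M} e
    ... | a , b , refl , refl , Mfafb = Mfafb

-- 2-matchings

module _ {n} {G : Graph n} {M : BRel n} (M-match : IsTwoMatching G M) where

  twoMatching-irrefl : ∀ i → M i i ≡ false
  twoMatching-irrefl i with M i i in Mii
  ... | false = refl
  ... | true  = trans (sym (proj₁ (proj₂ M-match) i i Mii)) (irrefl G i)

  twoMatching-handshake : degreeSum M ≡ 2 * edgeCount M
  twoMatching-handshake = handshake M (proj₁ M-match) twoMatching-irrefl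

module _ {n} (G : Graph n) {k} (ν : TwoMatchingNumber G k) where

  maximum-degreeSum : ∃[ M ] (IsTwoMatching G M × degreeSum M ≡ 2 * k)
  maximum-degreeSum =
    let (M , M-match , |M|≡k) , _ = ν
    in M , M-match , trans (twoMatching-handshake {G = G} M-match) (cong (2 *_) |M|≡k)

  degreeSum-≤ : ∀ {M} → IsTwoMatching G M → degreeSum M ≤ 2 * k
  degreeSum-≤ {M} M-match =
    ≤-trans (≤-reflexive (twoMatching-handshake {G = G} M-match)) (*-monoʳ-≤ 2 (proj₂ ν M M-match))

-- Exchanging an edge of a 2-matching

does-true : ∀ {a} {A : Set a} (A? : Dec A) → does A? ≡ true → A
does-true (yes a) _ = a

edge : ∀ {n} → Fin n → Fin n → BRel n
edge x y i j = does ((x ≟ i ×-dec y ≟ j) ⊎-dec (y ≟ i ×-dec x ≟ j))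

edge-true : ∀ {n} (x y i j : Fin n) → edge x y i j ≡ true → (x ≡ i × y ≡ j) ⊎ (y ≡ i × x ≡ j)
edge-true x y i j = does-true ((x ≟ i ×-dec y ≟ j) ⊎-dec (y ≟ i ×-dec x ≟ j))

edge-sym : ∀ {n} (x y i j : Fin n) → edge x y i j ≡ edge x y j i
edge-sym x y i j =
  trans (cong₂ _∨_ (∧-comm (does (x ≟ i)) (does (y ≟ j))) (∧-comm (does (y ≟ i)) (does (x ≟ j))))
        (∨-comm (does (y ≟ j) ∧ does (x ≟ i)) (does (x ≟ j) ∧ does (y ≟ i)))

degB-edge : ∀ {n} {x y : Fin n} → x ≢ y → ∀ a → degB (edge x y) a ≡ δ x a + δ y a
degB-edge {n} {x} {y} x≢y a with x ≟ a | y ≟ a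
... | yes refl | yes refl = ⊥-elim (x≢y refl)
... | yes refl | no  _    =
  trans (sum-cong (λ j → cong χ (∨-identityʳ (does (y ≟ j))))) (sum-δ-one y)
... | no  _    | yes refl = sum-δ-one x
... | no  _    | no  _    = sum-zero {n} (λ _ → refl)

degreeSum-edge : ∀ {n} {x y : Fin n} → x ≢ y → degreeSum (edge x y) ≡ 2
degreeSum-edge {x = x} {y} x≢y =
  trans (sum-cong (degB-edge x≢y))
        (trans (sum-+ (δ x) (δ y)) (cong₂ _+_ (sum-δ-one x) (sum-δ-one y)))

χ-exchange : ∀ m x y → (x ≡ true → m ≡ true) → (y ≡ true → m ≡ false) → (x ≡ true → y ≡ false) →
             χ ((m ∧ not x) ∨ y) + χ x ≡ χ m + χ y
χ-exchange true  true  true  _   _    x⇒¬y with () ← x⇒¬y refl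
χ-exchange true  true  false _   _    _    = refl
χ-exchange true  false true  _   y⇒¬m _    with () ← y⇒¬m refl
χ-exchange true  false false _   _    _    = refl
χ-exchange false true  _     x⇒m _    _    with () ← x⇒m refl
χ-exchange false false true  _   _    _    = refl
χ-exchange false false false _   _    _    = refl

+-cancel-common : ∀ x y s t w → x + (s + t) ≡ y + (s + w) → x ≤ y + w
+-cancel-common x y s t w eq = +-cancelʳ-≤ s x (y + w) (begin
  x + s        ≤⟨ +-monoʳ-≤ x (m≤m+n s t) ⟩
  x + (s + t)  ≡⟨ eq ⟩
  y + (s + w)  ≡⟨ cong (y +_) (+-comm s w) ⟩
  y + (w + s)  ≡⟨ +-assoc y w s ⟨
  y + w + s    ∎)
  where open ≤-Reasoning

module Exchange {n} {G : Graph n} {M : BRel n} (M-match : IsTwoMatching G M) {c v u : Fin n}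
                (Mcv : M c v ≡ true) (Gcu : Adj G c u) (Mcu : M c u ≡ false) (u-deg : degB M u ≤ 1)
                where

  exchanged : BRel n
  exchanged = (M ∖ edge c v) ∪ edge c u

  private
    M-sym : ∀ i j → M i j ≡ M j i
    M-sym = proj₁ M-match

    c≢v : c ≢ v
    c≢v refl with () ← trans (sym Mcv) (twoMatching-irrefl {G = G} M-match c)

    c≢u : c ≢ u
    c≢u refl with () ← trans (sym Gcu) (irrefl G c)

    v≢u : v ≢ u
    v≢u refl with () ← trans (sym Mcv) Mcu

    edge-cv⊆M : ∀ {i j} → edge c v i j ≡ true → M i j ≡ true
    edge-cv⊆M {i} {j} e with edge-true c v i j e
    ... | inj₁ (refl , refl) = Mcv
    ... | inj₂ (refl , refl) = trans (M-sym v c) Mcv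

    edge-cu∉M : ∀ {i j} → edge c u i j ≡ true → M i j ≡ false
    edge-cu∉M {i} {j} e with edge-true c u i j e
    ... | inj₁ (refl , refl) = Mcu
    ... | inj₂ (refl , refl) = trans (M-sym u c) Mcu

    edge-cv∉cu : ∀ {i j} → edge c v i j ≡ true → edge c u i j ≡ false
    edge-cv∉cu {i} {j} e with edge c u i j in e′
    ... | false = refl
    ... | true with edge-true c v i j e | edge-true c u i j e′
    ...   | inj₁ (refl , refl) | inj₁ (_ , u≡v)  = ⊥-elim (v≢u (sym u≡v))
    ...   | inj₁ (refl , refl) | inj₂ (_ , c≡v)  = ⊥-elim (c≢v c≡v)
    ...   | inj₂ (refl , refl) | inj₁ (c≡v , _)  = ⊥-elim (c≢v c≡v)
    ...   | inj₂ (refl , refl) | inj₂ (u≡v , _)  = ⊥-elim (v≢u (sym u≡v))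

    exchange-degB : ∀ a → degB exchanged a + degB (edge c v) a ≡ degB M a + degB (edge c u) a
    exchange-degB a = begin
      degB exchanged a + degB (edge c v) a                 ≡⟨ sum-+ (χ ∘ exchanged a) (χ ∘ edge c v a) ⟨
      sumFin (λ b → χ (exchanged a b) + χ (edge c v a b))  ≡⟨ sum-cong key ⟩
      sumFin (λ b → χ (M a b) + χ (edge c u a b))          ≡⟨ sum-+ (χ ∘ M a) (χ ∘ edge c u a) ⟩
      degB M a + degB (edge c u) a                         ∎
      where
      open ≡-Reasoning
      key : ∀ b → χ (exchanged a b) + χ (edge c v a b) ≡ χ (M a b) + χ (edge c u a b)
      key b = χ-exchange (M a b) (edge c v a b) (edge c u a b) edge-cv⊆M edge-cu∉M edge-cv∉cu

    exchange-degB-≤ : ∀ a → degB exchanged a ≤ degB M a + δ u a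
    exchange-degB-≤ a = +-cancel-common _ _ (δ c a) (δ v a) (δ u a)
      (trans (cong (degB exchanged a +_) (sym (degB-edge c≢v a)))
             (trans (exchange-degB a) (cong (degB M a +_) (degB-edge c≢u a))))

  exchange-degB-v : suc (degB exchanged v) ≡ degB M v
  exchange-degB-v = begin
    suc (degB exchanged v)                 ≡⟨ +-comm 1 _ ⟩
    degB exchanged v + 1                   ≡⟨ cong (degB exchanged v +_) edge-cv-at-v ⟨
    degB exchanged v + degB (edge c v) v   ≡⟨ exchange-degB v ⟩
    degB M v + degB (edge c u) v           ≡⟨ cong (degB M v +_) edge-cu-at-v ⟩
    degB M v + 0                           ≡⟨ +-identityʳ _ ⟩
    degB M v                               ∎
    where
    open ≡-Reasoning
    edge-cv-at-v : degB (edge c v) v ≡ 1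
    edge-cv-at-v = trans (degB-edge c≢v v) (cong₂ _+_ (δ-≢ c≢v) (δ-refl v))
    edge-cu-at-v : degB (edge c u) v ≡ 0
    edge-cu-at-v = trans (degB-edge c≢u v) (cong₂ _+_ (δ-≢ c≢v) (δ-≢ (v≢u ∘ sym)))

  exchange-degreeSum : degreeSum exchanged ≡ degreeSum M
  exchange-degreeSum = +-cancelʳ-≡ 2 _ _ (begin
    degreeSum exchanged + 2                              ≡⟨ cong (degreeSum exchanged +_) (degreeSum-edge c≢v) ⟨
    degreeSum exchanged + degreeSum (edge c v)           ≡⟨ sum-+ (degB exchanged) (degB (edge c v)) ⟨
    sumFin (λ a → degB exchanged a + degB (edge c v) a)  ≡⟨ sum-cong exchange-degB ⟩
    sumFin (λ a → degB M a + degB (edge c u) a)          ≡⟨ sum-+ (degB M) (degB (edge c u)) ⟩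
    degreeSum M + degreeSum (edge c u)                   ≡⟨ cong (degreeSum M +_) (degreeSum-edge c≢u) ⟩
    degreeSum M + 2                                      ∎)
    where open ≡-Reasoning

  exchange-twoMatching : IsTwoMatching G exchanged
  exchange-twoMatching = exchanged-sym , exchanged⊆G , exchanged-deg
    where
    exchanged-sym : ∀ i j → exchanged i j ≡ exchanged j i
    exchanged-sym i j =
      cong₂ _∨_ (cong₂ _∧_ (M-sym i j) (cong not (edge-sym c v i j))) (edge-sym c u i j)

    edge-cu⊆G : edge c u ⊆ adj G
    edge-cu⊆G i j e with edge-true c u i j e
    ... | inj₁ (refl , refl) = Gcu
    ... | inj₂ (refl , refl) = trans (Graph.sym G u c) Gcu

    exchanged⊆G : exchanged ⊆ adj G
    exchanged⊆G i j e with M i j in Mij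
    ... | true  = proj₁ (proj₂ M-match) i j Mij
    ... | false = edge-cu⊆G i j e

    exchanged-deg : ∀ a → degB exchanged a ≤ 2
    exchanged-deg a with a ≟ u
    ... | yes refl = ≤-trans (exchange-degB-≤ u)
                       (≤-trans (≤-reflexive (cong (degB M u +_) (δ-refl u))) (+-monoˡ-≤ 1 u-deg))
    ... | no  a≢u  = ≤-trans (exchange-degB-≤ a)
                       (≤-trans (≤-reflexive (trans (cong (degB M a +_) (δ-≢ (a≢u ∘ sym)))
                                                    (+-identityʳ _)))
                                (proj₂ (proj₂ M-match) a))

free-neighbour : ∀ {n} {G : Graph n} {M : BRel n} {c} →
                 degB M c < deg G c → ∃[ u ] (Adj G c u × M c u ≡ false)
free-neighbour {G = G} {M} {c} degM<degG =
  let u , χMcu<χGcu = sum-<-witness (χ ∘ M c) (χ ∘ adj G c) degM<degG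
      Mcu , Gcu     = χ-< χMcu<χGcu
  in u , Gcu , Mcu

module _ {p} {S : Graph p} {c vs : Fin p} (S-starlike : IsStarlikeWithCentre S c)
         (vs-leaf : deg S vs ≡ 1) (vs∼c : Adj S vs c) where

  leaf-avoiding : ∀ {M} → IsTwoMatching S M →
                  ∃[ M′ ] (IsTwoMatching S M′ × degreeSum M′ ≡ degreeSum M × degB M′ vs ≡ 0)
  leaf-avoiding {M} M-match@(M-sym , M⊆S , M-deg) with M vs c in Mvsc
  ... | false =
    M , M-match , refl , n<1⇒n≡0 (subst (degB M vs <_) vs-leaf (degB-< M⊆S {vs} {c} Mvsc vs∼c))
  ... | true with free-neighbour {G = S} {M} (<-≤-trans (s≤s (M-deg c)) (proj₁ (proj₂ S-starlike)))
  ...   | u , Scu , Mcu =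
    exchanged , exchange-twoMatching , exchange-degreeSum ,
    n<1⇒n≡0 (subst₂ _≤_ (sym exchange-degB-v) vs-leaf (degB-mono M⊆S vs))
    where
    c≢u : c ≢ u
    c≢u refl with () ← trans (sym Scu) (irrefl S c)
    u-not-branch : deg S u ≤ 2
    u-not-branch = ≤-pred (≰⇒> (λ 3≤degu → c≢u (sym (proj₂ (proj₂ S-starlike) u 3≤degu))))
    u-deg : degB M u ≤ 1
    u-deg = ≤-pred (≤-trans (degB-< M⊆S {u} {c} (trans (M-sym u c) Mcu) (trans (Graph.sym S u c) Scu))
                            u-not-branch)
    open Exchange {G = S} M-match (trans (M-sym c vs) Mvsc) Scu Mcu u-deg

-- Gluing

injective : ∀ {p n} {f : Fin p → Fin n} → (∀ a b → f a ≡ f b → a ≡ b) → Injective _≡_ _≡_ f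
injective f-inj {a} {b} = f-inj a b

module _ {n p q} (T : Graph n) (S : Graph p) (T′ : Graph q) {vs : Fin p} {vt : Fin q} where

  split-twoMatching : IsGluing T S T′ vs vt → ∀ {M} → IsTwoMatching T M →
    ∃[ MS ] ∃[ MT ] (IsTwoMatching S MS × IsTwoMatching T′ MT ×
                     degreeSum M ≤ degreeSum MS + degreeSum MT)
  split-twoMatching (f , g , f-inj , g-inj , _ , _ , _ , f-adj , g-adj , edges) {M} M-match =
    restrict f M , restrict g M ,
    restrict-twoMatching {T = T} {S} {f} f-adj (injective f-inj) M-match ,
    restrict-twoMatching {T = T} {T′} {g} g-adj (injective g-inj) M-match ,
    (begin
      degreeSum M                            ≤⟨ degreeSum-mono covered ⟩
      degreeSum (Mᶠ ∪ Mᵍ)                    ≤⟨ degreeSum-∪ {R = Mᶠ} ⟩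
      degreeSum Mᶠ + degreeSum Mᵍ            ≡⟨ cong₂ _+_ (degreeSum-extend (injective f-inj))
                                                          (degreeSum-extend (injective g-inj)) ⟩
      degreeSum (restrict f M) + degreeSum (restrict g M)  ∎)
    where
    open ≤-Reasoning
    Mᶠ : BRel n
    Mᶠ = extend f (restrict f M)
    Mᵍ : BRel n
    Mᵍ = extend g (restrict g M)
    covered : M ⊆ (Mᶠ ∪ Mᵍ)
    covered i j Mij with edges i j (proj₁ (proj₂ M-match) i j Mij)
    ... | inj₁ (a , b , refl , refl) = cong (_∨ _) (trans (extend-image (injective f-inj) a b) Mij)
    ... | inj₂ (a , b , refl , refl) =
      trans (cong (_ ∨_) (trans (extend-image (injective g-inj) a b) Mij)) (∨-zeroʳ _)

  glue-twoMatchings : IsGluing T S T′ vs vt → ∀ {MS MT} → IsTwoMatching S MS → IsTwoMatching T′ MT →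
    degB MS vs + degB MT vt ≤ 2 →
    ∃[ M ] (IsTwoMatching T M × degreeSum M ≡ degreeSum MS + degreeSum MT)
  glue-twoMatchings (f , g , f-inj , g-inj , fvs≡gvt , meet , _ , f-adj , g-adj , _) {MS} {MT}
                    MS-match@(MS-sym , MS⊆S , MS-deg) (MT-sym , MT⊆T′ , MT-deg) deg-vs≤2 =
    MSᶠ ∪ MTᵍ ,
    (glued-sym , glued⊆T , glued-deg) ,
    (begin
      degreeSum (MSᶠ ∪ MTᵍ)          ≡⟨ degreeSum-∪-disjoint disjoint ⟩
      degreeSum MSᶠ + degreeSum MTᵍ  ≡⟨ cong₂ _+_ (degreeSum-extend f-inj′) (degreeSum-extend g-inj′) ⟩
      degreeSum MS + degreeSum MT    ∎)
    where
    open ≡-Reasoning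
    f-inj′ : Injective _≡_ _≡_ f
    f-inj′ = injective f-inj
    g-inj′ : Injective _≡_ _≡_ g
    g-inj′ = injective g-inj
    MSᶠ : BRel n
    MSᶠ = extend f MS
    MTᵍ : BRel n
    MTᵍ = extend g MT

    glued-sym : ∀ i j → (MSᶠ ∪ MTᵍ) i j ≡ (MSᶠ ∪ MTᵍ) j i
    glued-sym i j = cong₂ _∨_ (extend-sym f-inj′ MS-sym i j) (extend-sym g-inj′ MT-sym i j)

    glued⊆T : (MSᶠ ∪ MTᵍ) ⊆ adj T
    glued⊆T i j e with MSᶠ i j in MSᶠij
    ... | true  = extend-⊆ {T = T} {S} f-adj MS⊆S i j MSᶠij
    ... | false = extend-⊆ {T = T} {T′} g-adj MT⊆T′ i j e

    shared-only-vs : ∀ {a} → Image g (f a) → a ≡ vs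
    shared-only-vs {a} (b , gb≡fa) = proj₁ (meet a b (sym gb≡fa))

    disjoint : Disjoint MSᶠ MTᵍ
    disjoint i j MSᶠij with MTᵍ i j in MTᵍij
    ... | false = refl
    ... | true with extend-true {f = f} {MS} MSᶠij | extend-true {f = g} {MT} MTᵍij
    ...   | a , b , refl , refl , MSab | a′ , b′ , ga′≡fa , gb′≡fb , _
          with shared-only-vs (a′ , ga′≡fa) | shared-only-vs (b′ , gb′≡fb)
    ...     | refl | refl with () ← trans (sym MSab) (twoMatching-irrefl {G = S} MS-match vs)

    glued-deg : ∀ i → degB (MSᶠ ∪ MTᵍ) i ≤ 2
    glued-deg i = ≤-trans (degB-∪ {R = MSᶠ} {MTᵍ} i) (by-cases (image? f i) (image? g i))
      where
      by-cases : Dec (Image f i) → Dec (Image g i) → degB MSᶠ i + degB MTᵍ i ≤ 2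
      by-cases (yes (a , refl)) _ with a ≟ vs
      ... | yes refl rewrite degB-extend-image f-inj′ {MS} vs
                           | fvs≡gvt
                           | degB-extend-image g-inj′ {MT} vt = deg-vs≤2
      ... | no a≢vs rewrite degB-extend-image f-inj′ {MS} a
                          | degB-extend-outside {f = g} {MT} (a≢vs ∘ shared-only-vs)
                          | +-identityʳ (degB MS a) = MS-deg a
      by-cases (no i∉f) (yes (b , refl)) rewrite degB-extend-outside {f = f} {MS} i∉f
                                               | degB-extend-image g-inj′ {MT} b = MT-deg b
      by-cases (no i∉f) (no i∉g) rewrite degB-extend-outside {f = f} {MS} i∉f
                                       | degB-extend-outside {f = g} {MT} i∉g = z≤n

-- Neither the tree hypotheses nor the second branch vertex of T are needed.
lemma5p3 : ∀ {n p q} (T : Graph n) (S : Graph p) (T' : Graph q) (vs : Fin p) (vt : Fin q) →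
    IsTree T → IsStarlikeSplitting T S T' vs vt →
    ∀ a b c → TwoMatchingNumber T a → TwoMatchingNumber S b → TwoMatchingNumber T' c →
    a ≡ b + c
lemma5p3 T S T′ vs vt _ (_ , (centre , S-starlike , vs-leaf , vs∼centre) , _ , gluing)
         a b c ν-T ν-S ν-T′ =
  ≤-antisym (*-cancelˡ-≤ 2 ν-T≤) (*-cancelˡ-≤ 2 ν-T≥)
  where
  open ≤-Reasoning
  ν-T≤ : 2 * a ≤ 2 * (b + c)
  ν-T≤ with maximum-degreeSum T ν-T
  ... | M , M-match , ΣM≡2a with split-twoMatching T S T′ gluing M-match
  ...   | MS , MT , MS-match , MT-match , ΣM≤ = begin
    2 * a                        ≡⟨ ΣM≡2a ⟨
    degreeSum M                  ≤⟨ ΣM≤ ⟩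
    degreeSum MS + degreeSum MT  ≤⟨ +-mono-≤ (degreeSum-≤ S ν-S MS-match)
                                             (degreeSum-≤ T′ ν-T′ MT-match) ⟩
    2 * b + 2 * c                ≡⟨ *-distribˡ-+ 2 b c ⟨
    2 * (b + c)                  ∎
  ν-T≥ : 2 * (b + c) ≤ 2 * a
  ν-T≥ with maximum-degreeSum S ν-S | maximum-degreeSum T′ ν-T′
  ... | MS , MS-match , ΣMS≡2b | MT , MT-match , ΣMT≡2c
    with leaf-avoiding {S = S} S-starlike vs-leaf vs∼centre MS-match
  ... | MS′ , MS′-match , ΣMS′≡ΣMS , MS′-vs≡0
    with glue-twoMatchings T S T′ gluing MS′-match MT-match
           (subst (λ d → d + degB MT vt ≤ 2) (sym MS′-vs≡0) (proj₂ (proj₂ MT-match) vt))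
  ... | M , M-match , ΣM≡ = begin
    2 * (b + c)                   ≡⟨ *-distribˡ-+ 2 b c ⟩
    2 * b + 2 * c                 ≡⟨ cong₂ _+_ (trans ΣMS′≡ΣMS ΣMS≡2b) ΣMT≡2c ⟨
    degreeSum MS′ + degreeSum MT  ≡⟨ ΣM≡ ⟨
    degreeSum M                   ≤⟨ degreeSum-≤ T ν-T M-match ⟩
    2 * a                         ∎
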